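{- Let $k\ge2$, $a=2k-3$, and let $\pi\in\mathfrak S_{a+1}$ have one-line notation $[2,4,\dots,a+1,1,3,\dots,a]$. Then there is a unique (up to translation of the shape) increasing anti-straight Ferrers tableau $\mathsf T_\pi$ whose column reading word ${\sf read}(\mathsf T_\pi)$ is a reduced word for $\pi$.
   Context: A Ferrers diagram (English convention) is a left-justified array of boxes with weakly decreasing row lengths from top to bottom; an anti-straight Ferrers shape is the rotation by $180^\circ$ of a Ferrers diagram (a right-justified array with weakly increasing row lengths from top to bottom). An increasing tableau of such a shape is a filling by positive integers strictly increasing left to right along rows and top to bottom along columns. The column reading word reads the columns from left to right, each column from bottom to top. A word $b_1\cdots b_L$ is a reduced word for $\pi$ if $\pi=s_{b_1}\cdots s_{b_L}$ with $s_b=(b\ b{+}1)$ and $L$ equals the Coxeter length of $\pi$. -}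

module Defs where

open import Data.Nat using (ℕ; zero; suc; _+_; _*_; _∸_; _≤_; _<_; _⊔_; _≡ᵇ_; _≤ᵇ_)
open import Data.Bool using (Bool; true; false; if_then_else_; _∧_)
open import Data.List using (List; []; _∷_; length; map; reverse; concat; downFrom; upTo; _++_; foldr)
open import Data.List.Relation.Unary.All using (All)
open import Data.List.Relation.Unary.Linked using (Linked)
open import Data.Maybe using (Maybe; just; nothing)
open import Data.Product using (_×_; ∃; Σ)
open import Relation.Binary.PropositionalEquality using (_≡_; _≢_)

-- Permutations of ℕ (acting on {1,…,n}, identity elsewhere)

s : ℕ → ℕ → ℕ
s b x = if x ≡ᵇ b then suc b else (if x ≡ᵇ suc b then b else x)

prodW : List ℕ → ℕ → ℕ
prodW []      x = x
prodW (b ∷ w) x = s b (prodW w x)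

nth : List ℕ → ℕ → Maybe ℕ
nth []       _       = nothing
nth (x ∷ xs) zero    = just x
nth (x ∷ xs) (suc j) = nth xs j

nthD : List ℕ → ℕ → ℕ
nthD l j with nth l j
... | just y  = y
... | nothing = 0

permOf : List ℕ → ℕ → ℕ
permOf l x = if (1 ≤ᵇ x) ∧ (x ≤ᵇ length l) then nthD l (x ∸ 1) else x

oneLine : ℕ → List ℕ
oneLine k = map (λ i → 2 * suc i) (upTo (k ∸ 1)) ++ map (λ i → suc (2 * i)) (upTo (k ∸ 1))

Letter : ℕ → ℕ → Set
Letter a b = 1 ≤ b × b ≤ a

WordFor : ℕ → (ℕ → ℕ) → List ℕ → Set
WordFor a p w = All (Letter a) w × (∀ x → prodW w x ≡ p x)

Reduced : ℕ → (ℕ → ℕ) → List ℕ → Set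
Reduced a p w = WordFor a p w × (∀ w' → WordFor a p w' → length w ≤ length w')

-- Anti-straight Ferrers tableaux
-- A tableau is a list of rows, top to bottom; each row is listed left to right.
-- The shape is right-justified, rows nonempty with weakly increasing lengths
-- from top to bottom (so it is determined up to translation).

-- entrywise strict domination of a prefix: xs[j] < ys[j] for all j < length xs
-- (also forces length xs ≤ length ys)
data Below : List ℕ → List ℕ → Set where
  []  : ∀ {ys} → Below [] ys
  _∷_ : ∀ {x y xs ys} → x < y → Below xs ys → Below (x ∷ xs) (y ∷ ys)

-- two consecutive rows (upper, lower); rows are right-justified, so we compare
-- them read from the right
ColOK : List ℕ → List ℕ → Set
ColOK r₁ r₂ = Below (reverse r₁) (reverse r₂)

IsIncAntiStraight : List (List ℕ) → Set
IsIncAntiStraight T =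
  All (λ r → r ≢ []) T
  × All (All (λ x → 0 < x)) T
  × All (Linked _<_) T
  × Linked ColOK T                     -- weakly increasing row lengths, right
                                       -- justified, strictly increasing columns

-- column reading word: columns left to right, each column bottom to top
width : List (List ℕ) → ℕ
width T = foldr (λ r m → length r ⊔ m) 0 T

colFromRight : List (List ℕ) → ℕ → List ℕ   -- rows given bottom-to-top, reversed
colFromRight []       j = []
colFromRight (r ∷ rs) j with nth r j
... | just y  = y ∷ colFromRight rs j
... | nothing = colFromRight rs j

read : List (List ℕ) → List ℕ
read T = concat (map (colFromRight (map reverse (reverse T))) (downFrom (width T)))

-- Write d(f) = Σ_{1 ≤ x ≤ a+1} |f x − x|. Precomposing f with a simple transposition s_b raises d by at
-- most 2, and by exactly 2 iff f b ≤ b < f (b+1); call a word expanding if each of its letters does this.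
-- So every word for π has length at least d(π)/2, with equality exactly for expanding words: once one
-- expanding word for π exists, the reduced words for π are precisely the expanding ones.
--
-- Rotating an anti-straight tableau by 180° gives a Ferrers diagram with entries decreasing along rows and
-- columns, whose reading word ends with its first column. For π = [2, 4, …, 2m, 1, 3, …, 2m−1], a
-- decreasing run ending an expanding word must carry 2m from position 2m to position m, so it is
-- 2m−1, …, m+1, m, and what precedes it is an expanding word for the same pattern with m−1. Hence the
-- staircase with these runs as columns is the only candidate, and it does give an expanding word.

module Submission where

open import Defs
open import Data.Bool using (true; false; if_then_else_)
open import Data.List
  using (List; []; _∷_; length; map; reverse; reverseAcc; concat; downFrom; upTo; applyUpTo; _++_; _∷ʳ_)
open import Data.List.Properties
  using ( ++-assoc; ++-identityʳ; ∷-injectiveˡ; length-++; length-map; length-reverse; length-upTo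
        ; map-upTo; map-∘; map-id; map-cong; reverse-involutive; reverse-map; unfold-reverse )
open import Data.List.Relation.Unary.All using (All; []; _∷_)
import Data.List.Relation.Unary.All as All
import Data.List.Relation.Unary.All.Properties as Allₚ
open import Data.List.Relation.Unary.AllPairs using (AllPairs; []; _∷_)
open import Data.List.Relation.Unary.Linked using (Linked; []; [-]; _∷_)
import Data.List.Relation.Unary.Linked as Linked
import Data.List.Relation.Unary.Linked.Properties as Linkedₚ
open import Data.List.Relation.Binary.Permutation.Propositional using (↭-sym)
open import Data.List.Relation.Binary.Permutation.Propositional.Properties using (All-resp-↭; ↭-reverse)
open import Data.Maybe using (just; nothing)
open import Data.Nat using (ℕ; zero; suc; _+_; _*_; _∸_; _≤_; _<_; _>_; _⊔_; _≡ᵇ_; _≤ᵇ_; _<ᵇ_; z≤n; s≤s; ∣_-_∣)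
open import Data.Nat.Properties
open import Data.Nat.Tactic.RingSolver using (solve-∀)
open import Data.Product using (_×_; _,_; ∃; Σ; proj₁; proj₂)
open import Data.Sum using (inj₁; inj₂)
open import Data.Unit using (⊤; tt)
open import Function using (_∘_; flip; id)
open import Relation.Binary.Definitions using (tri<; tri≈; tri>)
open import Relation.Binary.PropositionalEquality
open import Relation.Nullary using (¬_; Dec; yes; no; contradiction)
open import Relation.Nullary.Decidable using (_×-dec_)

<ᵇ-true : ∀ {m n} → m < n → (m <ᵇ n) ≡ true
<ᵇ-true {zero}  {suc n} _       = refl
<ᵇ-true {suc m} {suc n} (s≤s p) = <ᵇ-true p

<ᵇ-false : ∀ {m n} → n ≤ m → (m <ᵇ n) ≡ false
<ᵇ-false {m}     {zero}  _       = refl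
<ᵇ-false {suc m} {suc n} (s≤s p) = <ᵇ-false p

≤ᵇ-true : ∀ {m n} → m ≤ n → (m ≤ᵇ n) ≡ true
≤ᵇ-true {zero}  _ = refl
≤ᵇ-true {suc m} p = <ᵇ-true p

≤ᵇ-false : ∀ {m n} → n < m → (m ≤ᵇ n) ≡ false
≤ᵇ-false {suc m} (s≤s p) = <ᵇ-false p

≡ᵇ-refl : ∀ m → (m ≡ᵇ m) ≡ true
≡ᵇ-refl zero    = refl
≡ᵇ-refl (suc m) = ≡ᵇ-refl m

≡ᵇ-false : ∀ {m n} → m ≢ n → (m ≡ᵇ n) ≡ false
≡ᵇ-false {zero}  {zero}  m≢n = contradiction refl m≢n
≡ᵇ-false {zero}  {suc n} _   = refl
≡ᵇ-false {suc m} {zero}  _   = refl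
≡ᵇ-false {suc m} {suc n} m≢n = ≡ᵇ-false (m≢n ∘ cong suc)

Linked-reverse : ∀ {A : Set} {R : A → A → Set} {xs} → Linked R xs → Linked (flip R) (reverse xs)
Linked-reverse {A} {R} {[]}     _ = []
Linked-reverse {A} {R} {x ∷ xs} l = go l [-]
  where
  go : ∀ {x xs acc} → Linked R (x ∷ xs) → Linked (flip R) (x ∷ acc) → Linked (flip R) (reverseAcc (x ∷ acc) xs)
  go [-]      acc = acc
  go (r ∷ l)  acc = go l (r ∷ acc)

All-reverse : ∀ {A : Set} {P : A → Set} {xs} → All P xs → All P (reverse xs)
All-reverse {xs = xs} = All-resp-↭ (↭-sym (↭-reverse xs))

-- Simple transpositions and the action of words

s-left : ∀ b → s b b ≡ suc b
s-left b rewrite ≡ᵇ-refl b = refl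

s-right : ∀ b → s b (suc b) ≡ b
s-right b rewrite ≡ᵇ-false (1+n≢n {b}) | ≡ᵇ-refl b = refl

s-fixes : ∀ {b x} → x ≢ b → x ≢ suc b → s b x ≡ x
s-fixes x≢b x≢1+b rewrite ≡ᵇ-false x≢b | ≡ᵇ-false x≢1+b = refl

s-fixes-below : ∀ {b x} → x < b → s b x ≡ x
s-fixes-below x<b = s-fixes (<⇒≢ x<b) (<⇒≢ (m<n⇒m<1+n x<b))

s-fixes-above : ∀ {b x} → suc b < x → s b x ≡ x
s-fixes-above 1+b<x = s-fixes (>⇒≢ (<-trans (n<1+n _) 1+b<x)) (>⇒≢ 1+b<x)

s-involutive : ∀ b x → s b (s b x) ≡ x
s-involutive b x with x ≟ b
... | yes refl rewrite s-left x = s-right x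
... | no x≢b with x ≟ suc b
...   | yes refl rewrite s-right b = s-left b
...   | no x≢1+b rewrite s-fixes x≢b x≢1+b = s-fixes x≢b x≢1+b

act : List ℕ → (ℕ → ℕ) → ℕ → ℕ
act []      f = f
act (b ∷ w) f = act w (f ∘ s b)

act≗∘prodW : ∀ w f → act w f ≗ f ∘ prodW w
act≗∘prodW []      f x = refl
act≗∘prodW (b ∷ w) f x = act≗∘prodW w (f ∘ s b) x

act-++ : ∀ xs ys f → act (xs ++ ys) f ≡ act ys (act xs f)
act-++ []       ys f = refl
act-++ (b ∷ xs) ys f = act-++ xs ys (f ∘ s b)

act-cong : ∀ w {f g} → f ≗ g → act w f ≗ act w g
act-cong []      f≗g = f≗g
act-cong (b ∷ w) f≗g = act-cong w (f≗g ∘ s b)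

act-reverse-cancel : ∀ w f → act (reverse w) (act w f) ≗ f
act-reverse-cancel []      f x = refl
act-reverse-cancel (b ∷ w) f x
  rewrite unfold-reverse b w | act-++ (reverse w) (b ∷ []) (act (b ∷ w) f)
  = trans (act-reverse-cancel w (f ∘ s b) (s b x)) (cong f (s-involutive b x))

Expands : (ℕ → ℕ) → ℕ → Set
Expands f b = f b ≤ b × b < f (suc b)

Expanding : List ℕ → (ℕ → ℕ) → Set
Expanding []      f = ⊤
Expanding (b ∷ w) f = Expands f b × Expanding w (f ∘ s b)

Expanding-cong : ∀ w {f g} → f ≗ g → Expanding w f → Expanding w g
Expanding-cong []      f≗g _ = tt
Expanding-cong (b ∷ w) f≗g ((fb≤b , b<fb+1) , ex) =
  (subst (_≤ b) (f≗g b) fb≤b , subst (b <_) (f≗g (suc b)) b<fb+1) , Expanding-cong w (f≗g ∘ s b) ex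

Expanding-++⁻ : ∀ xs ys f → Expanding (xs ++ ys) f → Expanding xs f × Expanding ys (act xs f)
Expanding-++⁻ []       ys f ex = tt , ex
Expanding-++⁻ (b ∷ xs) ys f (e , ex) with Expanding-++⁻ xs ys (f ∘ s b) ex
... | exs , eys = (e , exs) , eys

Expanding-++⁺ : ∀ xs ys f → Expanding xs f → Expanding ys (act xs f) → Expanding (xs ++ ys) f
Expanding-++⁺ []       ys f _          eys = eys
Expanding-++⁺ (b ∷ xs) ys f (e , exs) eys = e , Expanding-++⁺ xs ys (f ∘ s b) exs eys

Contracts : (ℕ → ℕ) → ℕ → Set
Contracts f d = f (suc d) ≤ d × d < f d

Contracting : List ℕ → (ℕ → ℕ) → Set
Contracting []      f = ⊤
Contracting (d ∷ u) f = Contracts f d × Contracting u (f ∘ s d)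

Contracting-cong : ∀ u {f g} → f ≗ g → Contracting u f → Contracting u g
Contracting-cong []      f≗g _ = tt
Contracting-cong (d ∷ u) f≗g ((p , q) , ct) =
  (subst (_≤ d) (f≗g (suc d)) p , subst (d <_) (f≗g d) q) , Contracting-cong u (f≗g ∘ s d) ct

Expanding-reverse⇒Contracting : ∀ u f g → Expanding (reverse u) f → act (reverse u) f ≗ g → Contracting u g
Expanding-reverse⇒Contracting []      f g _  _ = tt
Expanding-reverse⇒Contracting (d ∷ u) f g ex eq
  rewrite unfold-reverse d u with Expanding-++⁻ (reverse u) (d ∷ []) f ex
... | exu , ((hd≤d , d<hd+1) , _) =
  (subst (_≤ d) (trans (cong h (sym (s-right d))) (h∘sd≗g (suc d))) hd≤d ,
   subst (d <_) (trans (cong h (sym (s-left d))) (h∘sd≗g d)) d<hd+1) ,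
  Expanding-reverse⇒Contracting u f (g ∘ s d) exu (λ x → trans (cong h (sym (s-involutive d x))) (h∘sd≗g (s d x)))
  where
  h = act (reverse u) f
  h∘sd≗g : h ∘ s d ≗ g
  h∘sd≗g x = trans (sym (cong (λ w → w x) (act-++ (reverse u) (d ∷ []) f))) (eq x)

-- Displacement

∣m-n∣≡1+∣m-1+n∣ : ∀ {m n} → n < m → ∣ m - n ∣ ≡ suc ∣ m - suc n ∣
∣m-n∣≡1+∣m-1+n∣ {suc m} {zero}  _         = cong suc (sym (∣-∣-identityʳ m))
∣m-n∣≡1+∣m-1+n∣ {suc m} {suc n} (s≤s n<m) = ∣m-n∣≡1+∣m-1+n∣ n<m

∣m-1+n∣≡1+∣m-n∣ : ∀ {m n} → m ≤ n → ∣ m - suc n ∣ ≡ suc ∣ m - n ∣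
∣m-1+n∣≡1+∣m-n∣ {zero}  _         = refl
∣m-1+n∣≡1+∣m-n∣ {suc m} (s≤s m≤n) = ∣m-1+n∣≡1+∣m-n∣ m≤n

∣m-1+n∣≤1+∣m-n∣ : ∀ m n → ∣ m - suc n ∣ ≤ suc ∣ m - n ∣
∣m-1+n∣≤1+∣m-n∣ zero    n       = ≤-refl
∣m-1+n∣≤1+∣m-n∣ (suc m) zero    = m≤n⇒m≤1+n (≤-trans (≤-reflexive (∣-∣-identityʳ m)) (n≤1+n m))
∣m-1+n∣≤1+∣m-n∣ (suc m) (suc n) = ∣m-1+n∣≤1+∣m-n∣ m n

∣m-n∣≤1+∣m-1+n∣ : ∀ m n → ∣ m - n ∣ ≤ suc ∣ m - suc n ∣
∣m-n∣≤1+∣m-1+n∣ zero    n       = m≤n⇒m≤1+n (n≤1+n n)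
∣m-n∣≤1+∣m-1+n∣ (suc m) zero    = s≤s (≤-reflexive (sym (∣-∣-identityʳ m)))
∣m-n∣≤1+∣m-1+n∣ (suc m) (suc n) = ∣m-n∣≤1+∣m-1+n∣ m n

displacement : ℕ → (ℕ → ℕ) → ℕ
displacement zero    f = 0
displacement (suc N) f = displacement N f + ∣ f (suc N) - suc N ∣

displacement-local : ∀ N {f g} → (∀ x → x ≤ N → f x ≡ g x) → displacement N f ≡ displacement N g
displacement-local zero    _   = refl
displacement-local (suc N) f≡g = cong₂ _+_
  (displacement-local N (λ x x≤N → f≡g x (m≤n⇒m≤1+n x≤N)))
  (cong (∣_- suc N ∣) (f≡g (suc N) ≤-refl))

displacement-cong : ∀ N {f g} → f ≗ g → displacement N f ≡ displacement N g
displacement-cong N f≗g = displacement-local N (λ x _ → f≗g x)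

displacement-id : ∀ N → displacement N id ≡ 0
displacement-id zero    = refl
displacement-id (suc N) = cong₂ _+_ (displacement-id N) (∣n-n∣≡0 (suc N))

-- contributions of the positions b and b+1 to the displacement of f and of f ∘ s b
before after : (ℕ → ℕ) → ℕ → ℕ
before f b = ∣ f b - b ∣ + ∣ f (suc b) - suc b ∣
after  f b = ∣ f (suc b) - b ∣ + ∣ f b - suc b ∣

displacement-swap : ∀ {N b} f → 1 ≤ b → b < N →
  displacement N (f ∘ s b) + before f b ≡ displacement N f + after f b
displacement-swap {N} {suc c} f _ b<N =
  subst (λ M → displacement M (f ∘ s b) + before f b ≡ displacement M f + after f b)
        (m∸n+n≡m b<N) (go (N ∸ suc b))
  where
  b = suc c
  go : ∀ e → displacement (e + suc b) (f ∘ s b) + before f b ≡ displacement (e + suc b) f + after f b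
  go zero rewrite s-left b | s-right b
                | displacement-local c {f ∘ s b} {f} (λ x x≤c → cong f (s-fixes-below (s≤s x≤c)))
    = rearrange (displacement c f) _ _ _ _
    where
    rearrange : ∀ D p q r t → (D + p + q) + (r + t) ≡ (D + r + t) + (p + q)
    rearrange = solve-∀
  go (suc e) rewrite s-fixes-above {b} {suc (e + suc b)} (s≤s (m≤n+m (suc b) e))
    = add-both (displacement (e + suc b) (f ∘ s b)) (displacement (e + suc b) f) (go e)
    where
    add-both : ∀ X Y {z A B} → X + A ≡ Y + B → (X + z) + A ≡ (Y + z) + B
    add-both X Y {z} {A} {B} eq = trans (shift X z A) (trans (cong (_+ z) eq) (sym (shift Y z B)))
      where
      shift : ∀ X z A → (X + z) + A ≡ (X + A) + z
      shift = solve-∀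

Expands? : ∀ f b → Dec (Expands f b)
Expands? f b = (f b ≤? b) ×-dec (b <? f (suc b))

after-expands : ∀ {f b} → Expands f b → after f b ≡ 2 + before f b
after-expands {f} {b} (fb≤b , b<fb+1) = begin
  ∣ v - b ∣ + ∣ u - suc b ∣               ≡⟨ cong₂ _+_ (∣m-n∣≡1+∣m-1+n∣ b<fb+1) (∣m-1+n∣≡1+∣m-n∣ fb≤b) ⟩
  suc ∣ v - suc b ∣ + suc ∣ u - b ∣       ≡⟨ rearrange ∣ v - suc b ∣ ∣ u - b ∣ ⟩
  2 + (∣ u - b ∣ + ∣ v - suc b ∣)         ∎
  where
  open ≡-Reasoning
  rearrange : ∀ p q → suc p + suc q ≡ 2 + (q + p)
  rearrange = solve-∀
  u = f b
  v = f (suc b)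

after-not-expands : ∀ {f b} → ¬ Expands f b → after f b ≤ before f b
after-not-expands {f} {b} ¬ex with f b ≤? b | b <? f (suc b)
... | yes u≤b | yes b<v = contradiction (u≤b , b<v) ¬ex
... | no u≰b  | _       = begin
  ∣ v - b ∣ + ∣ u - suc b ∣          ≤⟨ +-monoˡ-≤ ∣ u - suc b ∣ (∣m-n∣≤1+∣m-1+n∣ v b) ⟩
  suc ∣ v - suc b ∣ + ∣ u - suc b ∣  ≡⟨ cong suc (+-comm ∣ v - suc b ∣ ∣ u - suc b ∣) ⟩
  suc ∣ u - suc b ∣ + ∣ v - suc b ∣  ≡⟨ cong (_+ ∣ v - suc b ∣) (∣m-n∣≡1+∣m-1+n∣ (≰⇒> u≰b)) ⟨
  ∣ u - b ∣ + ∣ v - suc b ∣          ∎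
  where
  open ≤-Reasoning
  u = f b
  v = f (suc b)
... | yes u≤b | no b≮v  = begin
  ∣ v - b ∣ + ∣ u - suc b ∣          ≤⟨ +-monoʳ-≤ ∣ v - b ∣ (∣m-1+n∣≤1+∣m-n∣ u b) ⟩
  ∣ v - b ∣ + suc ∣ u - b ∣          ≡⟨ exchange ∣ v - b ∣ ∣ u - b ∣ ⟩
  ∣ u - b ∣ + suc ∣ v - b ∣          ≡⟨ cong (∣ u - b ∣ +_) (∣m-1+n∣≡1+∣m-n∣ (≮⇒≥ b≮v)) ⟨
  ∣ u - b ∣ + ∣ v - suc b ∣          ∎
  where
  open ≤-Reasoning
  u = f b
  v = f (suc b)
  exchange : ∀ p q → p + suc q ≡ q + suc p
  exchange = solve-∀

module _ {a : ℕ} where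

  private
    N = suc a

    m+2+2*n≡m+2*[1+n] : ∀ m n → m + 2 + 2 * n ≡ m + 2 * suc n
    m+2+2*n≡m+2*[1+n] = solve-∀

  displacement-expands : ∀ {b} f → Letter a b → Expands f b →
    displacement N (f ∘ s b) ≡ displacement N f + 2
  displacement-expands {b} f (1≤b , b≤a) ex = +-cancelʳ-≡ (before f b) _ _ (begin
    displacement N (f ∘ s b) + before f b  ≡⟨ displacement-swap f 1≤b (s≤s b≤a) ⟩
    displacement N f + after f b           ≡⟨ cong (displacement N f +_) (after-expands {f} ex) ⟩
    displacement N f + (2 + before f b)    ≡⟨ +-assoc (displacement N f) 2 (before f b) ⟨
    displacement N f + 2 + before f b      ∎)
    where open ≡-Reasoning

  displacement-not-expands : ∀ {b} f → Letter a b → ¬ Expands f b →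
    displacement N (f ∘ s b) ≤ displacement N f
  displacement-not-expands {b} f (1≤b , b≤a) ¬ex = +-cancelʳ-≤ (before f b) _ _ (begin
    displacement N (f ∘ s b) + before f b  ≡⟨ displacement-swap f 1≤b (s≤s b≤a) ⟩
    displacement N f + after f b           ≤⟨ +-monoʳ-≤ (displacement N f) (after-not-expands {f} ¬ex) ⟩
    displacement N f + before f b          ∎)
    where open ≤-Reasoning

  displacement-act-≤ : ∀ w f → All (Letter a) w →
    displacement N (act w f) ≤ displacement N f + 2 * length w
  displacement-act-≤ []      f []       = ≤-reflexive (sym (+-identityʳ _))
  displacement-act-≤ (b ∷ w) f (l ∷ ls) = begin
    displacement N (act w (f ∘ s b))          ≤⟨ displacement-act-≤ w (f ∘ s b) ls ⟩
    displacement N (f ∘ s b) + 2 * length w   ≤⟨ +-monoˡ-≤ (2 * length w) one-step ⟩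
    displacement N f + 2 + 2 * length w       ≡⟨ m+2+2*n≡m+2*[1+n] (displacement N f) (length w) ⟩
    displacement N f + 2 * suc (length w)     ∎
    where
    open ≤-Reasoning
    one-step : displacement N (f ∘ s b) ≤ displacement N f + 2
    one-step with Expands? f b
    ... | yes ex  = ≤-reflexive (displacement-expands f l ex)
    ... | no ¬ex = ≤-trans (displacement-not-expands f l ¬ex) (m≤m+n _ 2)

  displacement-act-expanding : ∀ w f → All (Letter a) w → Expanding w f →
    displacement N (act w f) ≡ displacement N f + 2 * length w
  displacement-act-expanding []      f []       _         = sym (+-identityʳ _)
  displacement-act-expanding (b ∷ w) f (l ∷ ls) (ex , exs) = begin
    displacement N (act w (f ∘ s b))          ≡⟨ displacement-act-expanding w (f ∘ s b) ls exs ⟩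
    displacement N (f ∘ s b) + 2 * length w   ≡⟨ cong (_+ 2 * length w) (displacement-expands f l ex) ⟩
    displacement N f + 2 + 2 * length w       ≡⟨ m+2+2*n≡m+2*[1+n] (displacement N f) (length w) ⟩
    displacement N f + 2 * suc (length w)     ∎
    where open ≡-Reasoning

  displacement-act-tight⇒expanding : ∀ w f → All (Letter a) w →
    displacement N f + 2 * length w ≤ displacement N (act w f) → Expanding w f
  displacement-act-tight⇒expanding []      f []       _     = tt
  displacement-act-tight⇒expanding (b ∷ w) f (l ∷ ls) tight with Expands? f b
  ... | yes ex  = ex , displacement-act-tight⇒expanding w (f ∘ s b) ls (begin
    displacement N (f ∘ s b) + 2 * length w   ≡⟨ cong (_+ 2 * length w) (displacement-expands f l ex) ⟩
    displacement N f + 2 + 2 * length w       ≡⟨ m+2+2*n≡m+2*[1+n] (displacement N f) (length w) ⟩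
    displacement N f + 2 * suc (length w)     ≤⟨ tight ⟩
    displacement N (act w (f ∘ s b))          ∎)
    where open ≤-Reasoning
  ... | no ¬ex = contradiction tight (<⇒≱ (begin-strict
    displacement N (act w (f ∘ s b))          ≤⟨ displacement-act-≤ w (f ∘ s b) ls ⟩
    displacement N (f ∘ s b) + 2 * length w   ≤⟨ +-monoˡ-≤ (2 * length w) (displacement-not-expands f l ¬ex) ⟩
    displacement N f + 2 * length w           <⟨ +-monoʳ-< (displacement N f) (*-monoʳ-< 2 (n<1+n (length w))) ⟩
    displacement N f + 2 * suc (length w)     ∎))
    where open ≤-Reasoning

module _ {a : ℕ} {p : ℕ → ℕ} where

  private
    N = suc a

  act-wordFor : ∀ {w} → WordFor a p w → act w id ≗ p
  act-wordFor {w} (_ , w≗p) x = trans (act≗∘prodW w id x) (w≗p x)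

  displacement-wordFor : ∀ {w} → WordFor a p w → displacement N (act w id) ≡ displacement N p
  displacement-wordFor wf = displacement-cong N (act-wordFor wf)

  displacement≤2*length : ∀ {w} → WordFor a p w → displacement N p ≤ 2 * length w
  displacement≤2*length {w} wf@(ls , _) = begin
    displacement N p                      ≡⟨ displacement-wordFor wf ⟨
    displacement N (act w id)             ≤⟨ displacement-act-≤ w id ls ⟩
    displacement N id + 2 * length w      ≡⟨ cong (_+ 2 * length w) (displacement-id N) ⟩
    2 * length w                          ∎
    where open ≤-Reasoning

  displacement≡2*length : ∀ {w} → WordFor a p w → Expanding w id → displacement N p ≡ 2 * length w
  displacement≡2*length {w} wf@(ls , _) ex = begin
    displacement N p                      ≡⟨ displacement-wordFor wf ⟨
    displacement N (act w id)             ≡⟨ displacement-act-expanding w id ls ex ⟩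
    displacement N id + 2 * length w      ≡⟨ cong (_+ 2 * length w) (displacement-id N) ⟩
    2 * length w                          ∎
    where open ≡-Reasoning

  expanding⇒reduced : ∀ {w} → WordFor a p w → Expanding w id → Reduced a p w
  expanding⇒reduced {w} wf ex = wf , λ w′ wf′ → *-cancelˡ-≤ 2 (begin
    2 * length w   ≡⟨ displacement≡2*length wf ex ⟨
    displacement N p ≤⟨ displacement≤2*length wf′ ⟩
    2 * length w′  ∎)
    where open ≤-Reasoning

  reduced⇒expanding : ∀ {w₀ w} → WordFor a p w₀ → Expanding w₀ id → Reduced a p w → Expanding w id
  reduced⇒expanding {w₀} {w} wf₀ ex₀ (wf@(ls , _) , minimal) =
    displacement-act-tight⇒expanding w id ls (begin
      displacement N id + 2 * length w   ≡⟨ cong (_+ 2 * length w) (displacement-id N) ⟩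
      2 * length w                       ≤⟨ *-monoʳ-≤ 2 (minimal w₀ wf₀) ⟩
      2 * length w₀                      ≡⟨ displacement≡2*length wf₀ ex₀ ⟨
      displacement N p                   ≡⟨ displacement-wordFor wf ⟨
      displacement N (act w id)          ∎)
    where open ≤-Reasoning

-- The permutations shuffle m j

2*m≡m+m : ∀ m → 2 * m ≡ m + m
2*m≡m+m = solve-∀

2*[1+m]≡2+2*m : ∀ m → 2 * suc m ≡ suc (suc (2 * m))
2*[1+m]≡2+2*m = solve-∀

2*[1+m]∸1≡1+2*m : ∀ m → 2 * suc m ∸ 1 ≡ suc (2 * m)
2*[1+m]∸1≡1+2*m m = cong (_∸ 1) (2*[1+m]≡2+2*m m)

1+2*m<2*[1+m] : ∀ m → suc (2 * m) < 2 * suc m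
1+2*m<2*[1+m] m = subst (suc (2 * m) <_) (sym (2*[1+m]≡2+2*m m)) ≤-refl

m≤2*m : ∀ m → m ≤ 2 * m
m≤2*m m = m≤m+n m (m + 0)

m<2*m : ∀ {m} → 1 ≤ m → m < 2 * m
m<2*m {m} 1≤m = m<m+n m (subst (0 <_) (sym (+-identityʳ m)) 1≤m)

2*m∸m≡m : ∀ m → 2 * m ∸ m ≡ m
2*m∸m≡m m = trans (m+n∸m≡n m (m + 0)) (+-identityʳ m)

-- For m ≤ j ≤ 2m, the one-line notation [2, 4, …, 2m−2, 1, 3, …, 2(j−m)−1, 2m, 2(j−m)+1, …, 2m−1]:
-- 2m sits at position j, and shuffle m m is π for k = m + 1 (see permOf-oneLine).
opaque
  shuffle : ℕ → ℕ → ℕ → ℕ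
  shuffle m j x =
    if x <ᵇ m then 2 * x else
    if x <ᵇ j then suc (2 * (x ∸ m)) else
    if x ≡ᵇ j then 2 * m else
    if x ≤ᵇ 2 * m then 2 * (x ∸ m) ∸ 1 else x

  shuffle-left : ∀ {m j x} → x < m → shuffle m j x ≡ 2 * x
  shuffle-left x<m rewrite <ᵇ-true x<m = refl

  shuffle-middle : ∀ {m j x} → m ≤ x → x < j → shuffle m j x ≡ suc (2 * (x ∸ m))
  shuffle-middle m≤x x<j rewrite <ᵇ-false m≤x | <ᵇ-true x<j = refl

  shuffle-at : ∀ {m j} → m ≤ j → shuffle m j j ≡ 2 * m
  shuffle-at {m} {j} m≤j rewrite <ᵇ-false m≤j | <ᵇ-false (≤-refl {j}) | ≡ᵇ-refl j = refl

  shuffle-right : ∀ {m j x} → m ≤ j → j < x → x ≤ 2 * m → shuffle m j x ≡ 2 * (x ∸ m) ∸ 1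
  shuffle-right {m} {j} {x} m≤j j<x x≤2m
    rewrite <ᵇ-false (≤-trans m≤j (<⇒≤ j<x)) | <ᵇ-false (<⇒≤ j<x) | ≡ᵇ-false (>⇒≢ j<x) | ≤ᵇ-true x≤2m
    = refl

  shuffle-beyond : ∀ {m j x} → j < x → 2 * m < x → shuffle m j x ≡ x
  shuffle-beyond {m} {j} {x} j<x 2m<x
    rewrite <ᵇ-false (≤-trans (m≤2*m m) (<⇒≤ 2m<x)) | <ᵇ-false (<⇒≤ j<x) | ≡ᵇ-false (>⇒≢ j<x) | ≤ᵇ-false 2m<x
    = refl

shuffle-step : ∀ {m j} → m ≤ j → j < 2 * m → shuffle m (suc j) ∘ s j ≗ shuffle m j
shuffle-step {m} {j} m≤j j<2m x with <-cmp x j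
... | tri< x<j _ _ rewrite s-fixes-below x<j with x <? m
...   | yes x<m = trans (shuffle-left x<m) (sym (shuffle-left x<m))
...   | no  x≮m = trans (shuffle-middle (≮⇒≥ x≮m) (m<n⇒m<1+n x<j)) (sym (shuffle-middle (≮⇒≥ x≮m) x<j))
shuffle-step {m} {j} m≤j j<2m x | tri≈ _ refl _ rewrite s-left x =
  trans (shuffle-at (m≤n⇒m≤1+n m≤j)) (sym (shuffle-at m≤j))
shuffle-step {m} {j} m≤j j<2m x | tri> _ x≢j j<x with x ≟ suc j
... | yes refl rewrite s-right j = begin
  shuffle m (suc j) j      ≡⟨ shuffle-middle m≤j (n<1+n j) ⟩
  suc (2 * (j ∸ m))        ≡⟨ 2*[1+m]∸1≡1+2*m (j ∸ m) ⟨
  2 * suc (j ∸ m) ∸ 1      ≡⟨ cong (λ y → 2 * y ∸ 1) (+-∸-assoc 1 m≤j) ⟨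
  2 * (suc j ∸ m) ∸ 1      ≡⟨ shuffle-right m≤j j<x j<2m ⟨
  shuffle m j (suc j)      ∎
  where open ≡-Reasoning
... | no x≢1+j rewrite s-fixes x≢j x≢1+j with 2 * m <? x
...   | yes 2m<x = trans (shuffle-beyond 1+j<x 2m<x) (sym (shuffle-beyond j<x 2m<x))
  where 1+j<x = ≤∧≢⇒< j<x (x≢1+j ∘ sym)
...   | no  2m≮x = trans (shuffle-right (m≤n⇒m≤1+n m≤j) 1+j<x (≮⇒≥ 2m≮x)) (sym (shuffle-right m≤j j<x (≮⇒≥ 2m≮x)))
  where 1+j<x = ≤∧≢⇒< j<x (x≢1+j ∘ sym)

shuffle-advance : ∀ {m j} → m ≤ j → j < 2 * m → shuffle m j ∘ s j ≗ shuffle m (suc j)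
shuffle-advance {m} {j} m≤j j<2m x =
  trans (sym (shuffle-step m≤j j<2m (s j x))) (cong (shuffle m (suc j)) (s-involutive j x))

shuffle-expands : ∀ {m j} → m ≤ j → j < 2 * m → Expands (shuffle m (suc j)) j
shuffle-expands {m} {j} m≤j j<2m =
  subst (_≤ j) (sym (shuffle-middle m≤j (n<1+n j))) 1+2*[j∸m]≤j ,
  subst (j <_) (sym (shuffle-at (m≤n⇒m≤1+n m≤j))) j<2m
  where
  open ≤-Reasoning
  e = j ∸ m
  j≡m+e : j ≡ m + e
  j≡m+e = sym (m+[n∸m]≡n m≤j)
  e<m : e < m
  e<m = +-cancelˡ-< m e m (subst₂ _<_ j≡m+e (2*m≡m+m m) j<2m)
  1+2*[j∸m]≤j : suc (2 * e) ≤ j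
  1+2*[j∸m]≤j = begin
    suc (2 * e)  ≡⟨ cong suc (2*m≡m+m e) ⟩
    suc e + e    ≤⟨ +-monoˡ-≤ e e<m ⟩
    m + e        ≡⟨ j≡m+e ⟨
    j            ∎

2*[d∸m]≤d : ∀ {m d} → m ≤ d → d ≤ 2 * m → 2 * (d ∸ m) ≤ d
2*[d∸m]≤d {m} {d} m≤d d≤2m = begin
  2 * (d ∸ m)        ≡⟨ 2*m≡m+m (d ∸ m) ⟩
  (d ∸ m) + (d ∸ m)  ≤⟨ +-monoˡ-≤ (d ∸ m) (m≤n+o⇒m∸n≤o d m (subst (d ≤_) (2*m≡m+m m) d≤2m)) ⟩
  m + (d ∸ m)        ≡⟨ m+[n∸m]≡n m≤d ⟩
  d                  ∎
  where open ≤-Reasoning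

contracts-shuffle : ∀ {m j d} → m ≤ j → j ≤ d → Contracts (shuffle m j) d → d ≡ j × j < 2 * m
contracts-shuffle {m} {j} {d} m≤j j≤d (_ , d<fd) with m≤n⇒m<n∨m≡n j≤d
... | inj₂ refl = refl , subst (d <_) (shuffle-at m≤j) d<fd
... | inj₁ j<d with 2 * m <? d
...   | yes 2m<d = contradiction (subst (d <_) (shuffle-beyond j<d 2m<d) d<fd) (<-irrefl refl)
...   | no  2m≮d = contradiction d<fd (≤⇒≯ (begin
  shuffle m j d        ≡⟨ shuffle-right m≤j j<d (≮⇒≥ 2m≮d) ⟩
  2 * (d ∸ m) ∸ 1      ≤⟨ m∸n≤m (2 * (d ∸ m)) 1 ⟩
  2 * (d ∸ m)          ≤⟨ 2*[d∸m]≤d (≤-trans m≤j (<⇒≤ j<d)) (≮⇒≥ 2m≮d) ⟩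
  d                    ∎))
  where open ≤-Reasoning

contracts-shuffle-diagonal : ∀ {m d} → Contracts (shuffle m m) d → m ≤ d
contracts-shuffle-diagonal {m} {d} (fd+1≤d , d<fd) with m ≤? d
... | yes m≤d = m≤d
... | no  m≰d with m≤n⇒m<n∨m≡n (≰⇒> m≰d)
...   | inj₁ 1+d<m = contradiction (subst (_≤ d) (shuffle-left 1+d<m) fd+1≤d) (<⇒≱ d<2*[1+d])
  where d<2*[1+d] = ≤-trans (n<1+n d) (m≤2*m (suc d))
...   | inj₂ refl  = contradiction (subst (_≤ d) (shuffle-at ≤-refl) fd+1≤d) (<⇒≱ d<2*[1+d])
  where d<2*[1+d] = ≤-trans (n<1+n d) (m≤2*m (suc d))

shuffle-zero : shuffle 0 0 ≗ id
shuffle-zero zero    = shuffle-at z≤n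
shuffle-zero (suc x) = shuffle-beyond (s≤s z≤n) (s≤s z≤n)

shuffle-2*m : ∀ {m} → 1 ≤ m → shuffle m m (2 * m) ≡ 2 * m ∸ 1
shuffle-2*m {m} 1≤m =
  trans (shuffle-right ≤-refl (m<2*m 1≤m) ≤-refl) (cong (λ y → 2 * y ∸ 1) (2*m∸m≡m m))

shuffle-end : ∀ m → shuffle (suc m) (2 * suc m) ≗ shuffle m m
shuffle-end m x with <-cmp x m
... | tri< x<m _ _    = trans (shuffle-left (m<n⇒m<1+n x<m)) (sym (shuffle-left x<m))
... | tri≈ _ refl _   = trans (shuffle-left (n<1+n x)) (sym (shuffle-at ≤-refl))
... | tri> _ _ m<x with <-cmp x (suc (2 * m))
...   | tri< x<1+2m _ _ = begin
  shuffle (suc m) (2 * suc m) x  ≡⟨ shuffle-middle m<x (<-trans x<1+2m (1+2*m<2*[1+m] m)) ⟩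
  suc (2 * (x ∸ suc m))          ≡⟨ 2*[1+m]∸1≡1+2*m (x ∸ suc m) ⟨
  2 * suc (x ∸ suc m) ∸ 1        ≡⟨ cong (λ y → 2 * y ∸ 1) (+-∸-assoc 1 m<x) ⟨
  2 * (suc x ∸ suc m) ∸ 1        ≡⟨ shuffle-right ≤-refl m<x (≤-pred x<1+2m) ⟨
  shuffle m m x                  ∎
  where open ≡-Reasoning
...   | tri≈ _ refl _   = begin
  shuffle (suc m) (2 * suc m) x  ≡⟨ shuffle-middle m<x (1+2*m<2*[1+m] m) ⟩
  suc (2 * (suc (2 * m) ∸ suc m)) ≡⟨ cong (λ y → suc (2 * y)) (2*m∸m≡m m) ⟩
  suc (2 * m)                    ≡⟨ shuffle-beyond m<x (n<1+n (2 * m)) ⟨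
  shuffle m m x                  ∎
  where open ≡-Reasoning
...   | tri> _ _ 1+2m<x with <-cmp x (2 * suc m)
...     | tri< x<2M _ _ = contradiction x<2M (≤⇒≯ (subst (_≤ x) (sym (2*[1+m]≡2+2*m m)) 1+2m<x))
...     | tri≈ _ refl _ = trans (shuffle-at (m≤2*m (suc m))) (sym (shuffle-beyond m<x 2m<x))
  where 2m<x = <-trans (n<1+n (2 * m)) 1+2m<x
...     | tri> _ _ 2M<x = trans (shuffle-beyond 2M<x 2M<x) (sym (shuffle-beyond m<x 2m<x))
  where 2m<x = <-trans (n<1+n (2 * m)) 1+2m<x

nth-applyUpTo : ∀ (f : ℕ → ℕ) {n i} → i < n → nth (applyUpTo f n) i ≡ just (f i)
nth-applyUpTo f {suc n} {zero}  _         = refl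
nth-applyUpTo f {suc n} {suc i} (s≤s i<n) = nth-applyUpTo (f ∘ suc) i<n

nth-++ˡ : ∀ xs {ys i} → i < length xs → nth (xs ++ ys) i ≡ nth xs i
nth-++ˡ (x ∷ xs) {i = zero}  _         = refl
nth-++ˡ (x ∷ xs) {i = suc i} (s≤s i<n) = nth-++ˡ xs i<n

nth-++ʳ : ∀ xs {ys} i → nth (xs ++ ys) (length xs + i) ≡ nth ys i
nth-++ʳ []       i = refl
nth-++ʳ (x ∷ xs) i = nth-++ʳ xs i

nthD-just : ∀ l j {v} → nth l j ≡ just v → nthD l j ≡ v
nthD-just l j eq with nth l j
nthD-just l j refl | just _ = refl

permOf-inside : ∀ l {x} → 1 ≤ x → x ≤ length l → permOf l x ≡ nthD l (x ∸ 1)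
permOf-inside l 1≤x x≤len rewrite ≤ᵇ-true 1≤x | ≤ᵇ-true x≤len = refl

permOf-outside : ∀ l {x} → length l < x → permOf l x ≡ x
permOf-outside l {suc x} len<x rewrite ≤ᵇ-false len<x = refl

module _ (m : ℕ) where

  private
    evens odds : List ℕ
    evens = map (λ i → 2 * suc i) (upTo m)
    odds  = map (λ i → suc (2 * i)) (upTo m)

    length-evens : length evens ≡ m
    length-evens = trans (length-map _ (upTo m)) (length-upTo m)

  length-oneLine : length (oneLine (suc m)) ≡ m + m
  length-oneLine = trans (length-++ evens) (cong₂ _+_ length-evens (trans (length-map _ (upTo m)) (length-upTo m)))

  nth-oneLine-evens : ∀ {i} → i < m → nth (oneLine (suc m)) i ≡ just (2 * suc i)
  nth-oneLine-evens {i} i<m = begin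
    nth (evens ++ odds) i                         ≡⟨ nth-++ˡ evens (subst (i <_) (sym length-evens) i<m) ⟩
    nth evens i                                   ≡⟨ cong (λ l → nth l i) (map-upTo _ m) ⟩
    nth (applyUpTo (λ i → 2 * suc i) m) i         ≡⟨ nth-applyUpTo _ i<m ⟩
    just (2 * suc i)                              ∎
    where open ≡-Reasoning

  nth-oneLine-odds : ∀ {i} → i < m → nth (oneLine (suc m)) (m + i) ≡ just (suc (2 * i))
  nth-oneLine-odds {i} i<m = begin
    nth (evens ++ odds) (m + i)                   ≡⟨ cong (λ n → nth (evens ++ odds) (n + i)) length-evens ⟨
    nth (evens ++ odds) (length evens + i)        ≡⟨ nth-++ʳ evens i ⟩
    nth odds i                                    ≡⟨ cong (λ l → nth l i) (map-upTo _ m) ⟩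
    nth (applyUpTo (λ i → suc (2 * i)) m) i       ≡⟨ nth-applyUpTo _ i<m ⟩
    just (suc (2 * i))                            ∎
    where open ≡-Reasoning

permOf-oneLine : ∀ m → permOf (oneLine (suc m)) ≗ shuffle m m
permOf-oneLine zero    zero = sym (shuffle-at z≤n)
permOf-oneLine (suc m) zero = sym (shuffle-left (s≤s z≤n))
permOf-oneLine m (suc y) with y <? m
... | yes y<m = begin
  permOf (oneLine (suc m)) (suc y)  ≡⟨ permOf-inside (oneLine (suc m)) (s≤s z≤n) 1+y≤length ⟩
  nthD (oneLine (suc m)) y          ≡⟨ nthD-just (oneLine (suc m)) y (nth-oneLine-evens m y<m) ⟩
  2 * suc y                         ≡⟨ evens-entry ⟩
  shuffle m m (suc y)               ∎
  where
  open ≡-Reasoning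
  1+y≤length = subst (suc y ≤_) (sym (length-oneLine m)) (≤-trans y<m (m≤m+n m m))
  evens-entry : 2 * suc y ≡ shuffle m m (suc y)
  evens-entry with m≤n⇒m<n∨m≡n y<m
  ... | inj₁ 1+y<m = sym (shuffle-left 1+y<m)
  ... | inj₂ refl  = sym (shuffle-at ≤-refl)
... | no y≮m with m≤n⇒∃[o]m+o≡n (≮⇒≥ y≮m)
...   | i , refl with i <? m
...     | yes i<m = begin
  permOf (oneLine (suc m)) (suc (m + i))  ≡⟨ permOf-inside (oneLine (suc m)) (s≤s z≤n) 1+m+i≤length ⟩
  nthD (oneLine (suc m)) (m + i)          ≡⟨ nthD-just (oneLine (suc m)) (m + i) (nth-oneLine-odds m i<m) ⟩
  suc (2 * i)                             ≡⟨ 2*[1+m]∸1≡1+2*m i ⟨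
  2 * suc i ∸ 1                           ≡⟨ cong (λ z → 2 * z ∸ 1) (m+n∸m≡n m (suc i)) ⟨
  2 * (m + suc i ∸ m) ∸ 1                 ≡⟨ cong (λ z → 2 * (z ∸ m) ∸ 1) (+-suc m i) ⟩
  2 * (suc (m + i) ∸ m) ∸ 1               ≡⟨ shuffle-right ≤-refl (s≤s (m≤m+n m i)) 1+m+i≤2m ⟨
  shuffle m m (suc (m + i))               ∎
  where
  open ≡-Reasoning
  1+m+i≤2m : suc (m + i) ≤ 2 * m
  1+m+i≤2m = subst₂ _≤_ (+-suc m i) (sym (2*m≡m+m m)) (+-monoʳ-≤ m i<m)
  1+m+i≤length = subst (suc (m + i) ≤_) (trans (2*m≡m+m m) (sym (length-oneLine m))) 1+m+i≤2m
...     | no i≮m = trans (permOf-outside (oneLine (suc m)) length<1+m+i)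
                         (sym (shuffle-beyond (s≤s (m≤m+n m i)) 2m<1+m+i))
  where
  2m<1+m+i : 2 * m < suc (m + i)
  2m<1+m+i = s≤s (subst (_≤ m + i) (sym (2*m≡m+m m)) (+-monoʳ-≤ m (≮⇒≥ i≮m)))
  length<1+m+i = subst (_< suc (m + i)) (trans (2*m≡m+m m) (sym (length-oneLine m))) 2m<1+m+i

countdown : ℕ → ℕ → List ℕ
countdown j zero    = []
countdown j (suc t) = j + t ∷ countdown j t

countup : ℕ → ℕ → List ℕ
countup j zero    = []
countup j (suc t) = j ∷ countup (suc j) t

countdown-∷ʳ : ∀ j t → countdown (suc j) t ∷ʳ j ≡ countdown j (suc t)
countdown-∷ʳ j zero    = cong (_∷ []) (sym (+-identityʳ j))
countdown-∷ʳ j (suc t) = cong₂ _∷_ (sym (+-suc j t)) (countdown-∷ʳ j t)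

reverse-countup : ∀ j t → reverse (countup j t) ≡ countdown j t
reverse-countup j zero    = refl
reverse-countup j (suc t) = begin
  reverse (j ∷ countup (suc j) t)    ≡⟨ unfold-reverse j (countup (suc j) t) ⟩
  reverse (countup (suc j) t) ∷ʳ j   ≡⟨ cong (_∷ʳ j) (reverse-countup (suc j) t) ⟩
  countdown (suc j) t ∷ʳ j           ≡⟨ countdown-∷ʳ j t ⟩
  countdown j (suc t)                ∎
  where open ≡-Reasoning

act-countdown : ∀ {m j} t → m ≤ j → j + t ≤ 2 * m → act (countdown j t) (shuffle m (j + t)) ≗ shuffle m j
act-countdown {m} {j} zero    m≤j _      x = cong (λ i → shuffle m i x) (+-identityʳ j)
act-countdown {m} {j} (suc t) m≤j j+t<2m x rewrite +-suc j t =
  trans (act-cong (countdown j t) (shuffle-step (≤-trans m≤j (m≤m+n j t)) j+t<2m) x)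
        (act-countdown t m≤j (<⇒≤ j+t<2m) x)

expanding-countdown : ∀ {m j} t → m ≤ j → j + t ≤ 2 * m → Expanding (countdown j t) (shuffle m (j + t))
expanding-countdown         zero    _   _      = tt
expanding-countdown {m} {j} (suc t) m≤j j+t<2m rewrite +-suc j t =
  shuffle-expands m≤j+t j+t<2m ,
  Expanding-cong (countdown j t) (λ x → sym (shuffle-step m≤j+t j+t<2m x))
    (expanding-countdown t m≤j (<⇒≤ j+t<2m))
  where m≤j+t = ≤-trans m≤j (m≤m+n j t)

contracting-shuffle : ∀ {m j u} → m ≤ j → j ≤ 2 * m → AllPairs _<_ u → All (j ≤_) u →
  Contracting u (shuffle m j) →
  ∃ λ t → u ≡ countup j t × j + t ≤ 2 * m × act u (shuffle m j) ≗ shuffle m (j + t)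
contracting-shuffle {m} {j} {[]} _ j≤2m _ _ _ =
  0 , refl , subst (_≤ 2 * m) (sym (+-identityʳ j)) j≤2m , λ x → cong (λ i → shuffle m i x) (sym (+-identityʳ j))
contracting-shuffle {m} {j} {d ∷ u} m≤j _ (d<u ∷ sorted) (j≤d ∷ _) (c , cs)
  with contracts-shuffle m≤j j≤d c
... | refl , j<2m with contracting-shuffle (m≤n⇒m≤1+n m≤j) j<2m sorted d<u
                         (Contracting-cong u (shuffle-advance m≤j j<2m) cs)
...   | t , refl , 1+j+t≤2m , acts =
  suc t , refl , subst (_≤ 2 * m) (sym (+-suc j t)) 1+j+t≤2m ,
  λ x → trans (act-cong u (shuffle-advance m≤j j<2m) x)
              (trans (acts x) (cong (λ i → shuffle m i x) (sym (+-suc j t))))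

-- Rotated tableaux

rotate : List (List ℕ) → List (List ℕ)
rotate T = map reverse (reverse T)

rotate-involutive : ∀ T → rotate (rotate T) ≡ T
rotate-involutive T = begin
  map reverse (reverse (map reverse (reverse T)))   ≡⟨ cong (map reverse) (reverse-map reverse (reverse T)) ⟨
  map reverse (map reverse (reverse (reverse T)))   ≡⟨ map-∘ (reverse (reverse T)) ⟨
  map (reverse ∘ reverse) (reverse (reverse T))     ≡⟨ map-cong reverse-involutive (reverse (reverse T)) ⟩
  map id (reverse (reverse T))                      ≡⟨ map-id (reverse (reverse T)) ⟩
  reverse (reverse T)                               ≡⟨ reverse-involutive T ⟩
  T                                                 ∎
  where open ≡-Reasoning

DecreasingTableau : List (List ℕ) → Set
DecreasingTableau R = All (_≢ []) R × All (Linked _>_) R × Linked (flip Below) R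

firstColumn : List (List ℕ) → List ℕ
firstColumn []             = []
firstColumn ([] ∷ R)       = firstColumn R
firstColumn ((x ∷ _) ∷ R)  = x ∷ firstColumn R

dropFirstColumn : List (List ℕ) → List (List ℕ)
dropFirstColumn []                 = []
dropFirstColumn ([] ∷ R)           = dropFirstColumn R
dropFirstColumn ((x ∷ []) ∷ R)     = dropFirstColumn R
dropFirstColumn ((x ∷ y ∷ r) ∷ R)  = (y ∷ r) ∷ dropFirstColumn R

addFirstColumn : List ℕ → List (List ℕ) → List (List ℕ)
addFirstColumn []       _       = []
addFirstColumn (x ∷ xs) []      = (x ∷ []) ∷ addFirstColumn xs []
addFirstColumn (x ∷ xs) (r ∷ R) = (x ∷ r) ∷ addFirstColumn xs R

readColumns : List (List ℕ) → ℕ → List ℕ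
readColumns R n = concat (map (colFromRight R) (downFrom n))

readRotated : List (List ℕ) → List ℕ
readRotated R = readColumns R (width R)

colFromRight-zero : ∀ R → colFromRight R 0 ≡ firstColumn R
colFromRight-zero []            = refl
colFromRight-zero ([] ∷ R)      = colFromRight-zero R
colFromRight-zero ((x ∷ r) ∷ R) = cong (x ∷_) (colFromRight-zero R)

colFromRight-suc : ∀ R j → colFromRight R (suc j) ≡ colFromRight (dropFirstColumn R) j
colFromRight-suc []                 j = refl
colFromRight-suc ([] ∷ R)           j = colFromRight-suc R j
colFromRight-suc ((x ∷ []) ∷ R)     j = colFromRight-suc R j
colFromRight-suc ((x ∷ y ∷ r) ∷ R)  j with nth (y ∷ r) j
... | just z  = cong (z ∷_) (colFromRight-suc R j)
... | nothing = colFromRight-suc R j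

readColumns-suc : ∀ R n → readColumns R (suc n) ≡ readColumns (dropFirstColumn R) n ++ firstColumn R
readColumns-suc R zero    = trans (++-identityʳ _) (colFromRight-zero R)
readColumns-suc R (suc n) = trans (cong₂ _++_ (colFromRight-suc R n) (readColumns-suc R n))
  (sym (++-assoc (colFromRight (dropFirstColumn R) n) (readColumns (dropFirstColumn R) n) (firstColumn R)))

width-dropFirstColumn : ∀ R → width (dropFirstColumn R) ≡ width R ∸ 1
width-dropFirstColumn []       = refl
width-dropFirstColumn ([] ∷ R) = width-dropFirstColumn R
width-dropFirstColumn ((x ∷ []) ∷ R) with width R | width-dropFirstColumn R
... | zero  | eq = eq
... | suc w | eq = eq
width-dropFirstColumn ((x ∷ y ∷ r) ∷ R) with width R | width-dropFirstColumn R
... | zero  | eq = trans (cong (suc (length r) ⊔_) eq) (⊔-identityʳ _)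
... | suc w | eq = cong (suc (length r) ⊔_) eq

readRotated-firstColumn : ∀ x r R →
  readRotated ((x ∷ r) ∷ R) ≡ readRotated (dropFirstColumn ((x ∷ r) ∷ R)) ++ firstColumn ((x ∷ r) ∷ R)
readRotated-firstColumn x r R = split ((x ∷ r) ∷ R) (≤-trans (s≤s z≤n) (m≤m⊔n (suc (length r)) (width R)))
  where
  split : ∀ R → 1 ≤ width R → readRotated R ≡ readRotated (dropFirstColumn R) ++ firstColumn R
  split R 1≤w with width R | width-dropFirstColumn R
  ... | suc w | eq rewrite eq = readColumns-suc R w

DecreasingTableau-tail : ∀ {r R} → DecreasingTableau (r ∷ R) → DecreasingTableau R
DecreasingTableau-tail (_ ∷ ne , _ ∷ rows , cols) = ne , rows , Linked.tail cols

dropFirstColumn-under-singleton : ∀ x R → Linked (flip Below) ((x ∷ []) ∷ R) → All (_≢ []) R →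
  dropFirstColumn R ≡ []
dropFirstColumn-under-singleton x []                  _                 _          = refl
dropFirstColumn-under-singleton x ([] ∷ R)            _                 (ne ∷ _)   = contradiction refl ne
dropFirstColumn-under-singleton x ((y ∷ []) ∷ R)      (_ ∷ cols)        (_ ∷ nes)  =
  dropFirstColumn-under-singleton y R cols nes
dropFirstColumn-under-singleton x ((y ∷ z ∷ r) ∷ R)   ((_ ∷ ()) ∷ _)    _

DecreasingTableau-dropFirstColumn : ∀ R → DecreasingTableau R → DecreasingTableau (dropFirstColumn R)
DecreasingTableau-dropFirstColumn [] t = t
DecreasingTableau-dropFirstColumn ([] ∷ R) (ne ∷ _ , _) = contradiction refl ne
DecreasingTableau-dropFirstColumn ((x ∷ []) ∷ R) (_ ∷ nes , _ , cols)
  rewrite dropFirstColumn-under-singleton x R cols nes = [] , [] , []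
DecreasingTableau-dropFirstColumn ((x ∷ y ∷ r) ∷ R) t@(_ ∷ nes , (_ ∷ row) ∷ _ , cols)
  with DecreasingTableau-dropFirstColumn R (DecreasingTableau-tail t)
... | nes′ , rows′ , cols′ = (λ ()) ∷ nes′ , row ∷ rows′ , below R cols nes cols′
  where
  below : ∀ R → Linked (flip Below) ((x ∷ y ∷ r) ∷ R) → All (_≢ []) R →
    Linked (flip Below) (dropFirstColumn R) → Linked (flip Below) ((y ∷ r) ∷ dropFirstColumn R)
  below []                  _                   _           _     = [-]
  below ([] ∷ R)            _                   (ne ∷ _)    _     = contradiction refl ne
  below ((z ∷ []) ∷ R)      (_ ∷ cols)          (_ ∷ nes)   _
    rewrite dropFirstColumn-under-singleton z R cols nes = [-]
  below ((z ∷ w ∷ r′) ∷ R)  ((_ ∷ w<y) ∷ _)     _           cols′ = w<y ∷ cols′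

addFirstColumn-firstColumn : ∀ R → DecreasingTableau R → addFirstColumn (firstColumn R) (dropFirstColumn R) ≡ R
addFirstColumn-firstColumn [] _ = refl
addFirstColumn-firstColumn ([] ∷ R) (ne ∷ _ , _) = contradiction refl ne
addFirstColumn-firstColumn ((x ∷ []) ∷ R) t@(_ ∷ nes , _ , cols)
  with addFirstColumn-firstColumn R (DecreasingTableau-tail t)
... | eq rewrite dropFirstColumn-under-singleton x R cols nes = cong ((x ∷ []) ∷_) eq
addFirstColumn-firstColumn ((x ∷ y ∷ r) ∷ R) t =
  cong ((x ∷ y ∷ r) ∷_) (addFirstColumn-firstColumn R (DecreasingTableau-tail t))

firstColumn-decreasing : ∀ R → DecreasingTableau R → Linked _>_ (firstColumn R)
firstColumn-decreasing [] _ = []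
firstColumn-decreasing ([] ∷ R) (ne ∷ _ , _) = contradiction refl ne
firstColumn-decreasing ((x ∷ r) ∷ []) _ = [-]
firstColumn-decreasing ((x ∷ r) ∷ [] ∷ R) (_ ∷ ne ∷ _ , _) = contradiction refl ne
firstColumn-decreasing ((x ∷ r) ∷ (y ∷ r′) ∷ R) t@(_ , _ , (y<x ∷ _) ∷ _) =
  y<x ∷ firstColumn-decreasing ((y ∷ r′) ∷ R) (DecreasingTableau-tail t)

decreasing-≤-head : ∀ x r → Linked _>_ (x ∷ r) → All (_≤ x) (x ∷ r)
decreasing-≤-head x []      _            = ≤-refl ∷ []
decreasing-≤-head x (y ∷ r) (y<x ∷ row) =
  ≤-refl ∷ All.map (λ z≤y → ≤-trans z≤y (<⇒≤ y<x)) (decreasing-≤-head y r row)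

entries-≤-corner : ∀ x r R → DecreasingTableau ((x ∷ r) ∷ R) → All (All (_≤ x)) ((x ∷ r) ∷ R)
entries-≤-corner x r [] (_ , row ∷ _ , _) = decreasing-≤-head x r row ∷ []
entries-≤-corner x r ([] ∷ R) (_ ∷ ne ∷ _ , _) = contradiction refl ne
entries-≤-corner x r ((y ∷ r′) ∷ R) t@(_ , row ∷ _ , (y<x ∷ _) ∷ _) =
  decreasing-≤-head x r row ∷
  All.map (All.map (λ z≤y → ≤-trans z≤y (<⇒≤ y<x))) (entries-≤-corner y r′ R (DecreasingTableau-tail t))

All-nth : ∀ {P : ℕ → Set} r j → All P r → ∀ {y} → nth r j ≡ just y → P y
All-nth (x ∷ r) zero    (px ∷ _)  refl = px
All-nth (x ∷ r) (suc j) (_ ∷ pxs) eq   = All-nth r j pxs eq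

All-colFromRight : ∀ {P : ℕ → Set} R j → All (All P) R → All P (colFromRight R j)
All-colFromRight []      j _ = []
All-colFromRight (r ∷ R) j (pr ∷ pR) with nth r j in eq
... | just y  = All-nth r j pr eq ∷ All-colFromRight R j pR
... | nothing = All-colFromRight R j pR

All-readColumns : ∀ {P : ℕ → Set} R n → All (All P) R → All P (readColumns R n)
All-readColumns R zero    _  = []
All-readColumns R (suc n) pR = Allₚ.++⁺ (All-colFromRight R n pR) (All-readColumns R n pR)

-- The staircase

length-addFirstColumn : ∀ xs R → length R ≤ length xs → length (addFirstColumn xs R) ≡ length xs
length-addFirstColumn []       []      _       = refl
length-addFirstColumn (x ∷ xs) []      _       = cong suc (length-addFirstColumn xs [] z≤n)
length-addFirstColumn (x ∷ xs) (r ∷ R) (s≤s p) = cong suc (length-addFirstColumn xs R p)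

firstColumn-addFirstColumn : ∀ xs R → length R ≤ length xs → firstColumn (addFirstColumn xs R) ≡ xs
firstColumn-addFirstColumn []       []      _       = refl
firstColumn-addFirstColumn (x ∷ xs) []      _       = cong (x ∷_) (firstColumn-addFirstColumn xs [] z≤n)
firstColumn-addFirstColumn (x ∷ xs) (r ∷ R) (s≤s p) = cong (x ∷_) (firstColumn-addFirstColumn xs R p)

dropFirstColumn-addFirstColumn : ∀ xs R → length R ≤ length xs → All (_≢ []) R →
  dropFirstColumn (addFirstColumn xs R) ≡ R
dropFirstColumn-addFirstColumn []       []            _       _          = refl
dropFirstColumn-addFirstColumn (x ∷ xs) []            _       _          =
  dropFirstColumn-addFirstColumn xs [] z≤n []
dropFirstColumn-addFirstColumn (x ∷ xs) ([] ∷ R)      _       (ne ∷ _)   = contradiction refl ne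
dropFirstColumn-addFirstColumn (x ∷ xs) ((y ∷ r) ∷ R) (s≤s p) (_ ∷ nes)  =
  cong ((y ∷ r) ∷_) (dropFirstColumn-addFirstColumn xs R p nes)

All-addFirstColumn : ∀ {P : ℕ → Set} xs R → All P xs → All (All P) R → All (All P) (addFirstColumn xs R)
All-addFirstColumn []       R       _          _          = []
All-addFirstColumn (x ∷ xs) []      (px ∷ pxs) _          = (px ∷ []) ∷ All-addFirstColumn xs [] pxs []
All-addFirstColumn (x ∷ xs) (r ∷ R) (px ∷ pxs) (pr ∷ pR)  = (px ∷ pr) ∷ All-addFirstColumn xs R pxs pR

DecreasingTableau-addFirstColumn : ∀ xs R → Linked _>_ xs → DecreasingTableau R → Below (firstColumn R) xs →
  DecreasingTableau (addFirstColumn xs R)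
DecreasingTableau-addFirstColumn xs R dec (nes , rows , cols) below =
  nonempty xs R , decreasing xs R nes rows below , stacked xs R dec cols
  where
  nonempty : ∀ xs R → All (_≢ []) (addFirstColumn xs R)
  nonempty []       _       = []
  nonempty (x ∷ xs) []      = (λ ()) ∷ nonempty xs []
  nonempty (x ∷ xs) (r ∷ R) = (λ ()) ∷ nonempty xs R
  decreasing : ∀ xs R → All (_≢ []) R → All (Linked _>_) R → Below (firstColumn R) xs →
    All (Linked _>_) (addFirstColumn xs R)
  decreasing []       _             _          _            _            = []
  decreasing (x ∷ xs) []            _          _            _            = [-] ∷ decreasing xs [] [] [] []
  decreasing (x ∷ xs) ([] ∷ R)      (ne ∷ _)   _            _            = contradiction refl ne
  decreasing (x ∷ xs) ((y ∷ r) ∷ R) (_ ∷ nes)  (row ∷ rows) (y<x ∷ below) =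
    (y<x ∷ row) ∷ decreasing xs R nes rows below
  stacked : ∀ xs R → Linked _>_ xs → Linked (flip Below) R → Linked (flip Below) (addFirstColumn xs R)
  stacked []            _                _          _              = []
  stacked (x ∷ [])      []               _          _              = [-]
  stacked (x ∷ [])      (r ∷ R)          _          _              = [-]
  stacked (x ∷ y ∷ xs)  []               (y<x ∷ d)  _              = (y<x ∷ []) ∷ stacked (y ∷ xs) [] d []
  stacked (x ∷ y ∷ xs)  (r ∷ [])         (y<x ∷ d)  _              = (y<x ∷ []) ∷ stacked (y ∷ xs) [] d []
  stacked (x ∷ y ∷ xs)  (r ∷ r′ ∷ R)     (y<x ∷ d)  (r′<r ∷ cols)  =
    (y<x ∷ r′<r) ∷ stacked (y ∷ xs) (r′ ∷ R) d cols

length-countdown : ∀ j t → length (countdown j t) ≡ t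
length-countdown j zero    = refl
length-countdown j (suc t) = cong suc (length-countdown j t)

countdown-decreasing : ∀ j t → Linked _>_ (countdown j t)
countdown-decreasing j zero          = []
countdown-decreasing j (suc zero)    = [-]
countdown-decreasing j (suc (suc t)) = subst (j + t <_) (sym (+-suc j t)) ≤-refl ∷ countdown-decreasing j (suc t)

countdown-bounds : ∀ j t → All (λ e → j ≤ e × e < j + t) (countdown j t)
countdown-bounds j zero    = []
countdown-bounds j (suc t) = (m≤m+n j t , j+t<j+[1+t]) ∷
  All.map (λ (j≤e , e<j+t) → j≤e , <-trans e<j+t j+t<j+[1+t]) (countdown-bounds j t)
  where j+t<j+[1+t] = +-monoʳ-< j (n<1+n t)

Below-countdown : ∀ {j j′ t t′} → t ≤ t′ → j + t < j′ + t′ → Below (countdown j t) (countdown j′ t′)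
Below-countdown {t = zero}                _         _   = []
Below-countdown {j} {j′} {suc t} {suc t′} (s≤s t≤t′) lt =
  j+t<j′+t′ ∷ Below-countdown t≤t′ j+t<j′+t′
  where j+t<j′+t′ = ≤-pred (subst₂ _<_ (+-suc j t) (+-suc j′ t′) lt)

readRotated-addFirstColumn : ∀ x xs R → length R ≤ length (x ∷ xs) → All (_≢ []) R →
  readRotated (addFirstColumn (x ∷ xs) R) ≡ readRotated R ++ x ∷ xs
readRotated-addFirstColumn x xs R fits nes = begin
  readRotated (addFirstColumn (x ∷ xs) R)  ≡⟨ split R ⟩
  readRotated (dropFirstColumn R′) ++ firstColumn R′
    ≡⟨ cong₂ (λ S c → readRotated S ++ c) (dropFirstColumn-addFirstColumn (x ∷ xs) R fits nes)
                                            (firstColumn-addFirstColumn (x ∷ xs) R fits) ⟩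
  readRotated R ++ x ∷ xs                  ∎
  where
  open ≡-Reasoning
  R′ = addFirstColumn (x ∷ xs) R
  split : ∀ R → readRotated (addFirstColumn (x ∷ xs) R)
              ≡ readRotated (dropFirstColumn (addFirstColumn (x ∷ xs) R)) ++ firstColumn (addFirstColumn (x ∷ xs) R)
  split []      = readRotated-firstColumn x [] (addFirstColumn xs [])
  split (r ∷ R) = readRotated-firstColumn x r (addFirstColumn xs R)

staircase : ℕ → List (List ℕ)
staircase zero    = []
staircase (suc m) = addFirstColumn (countdown (suc m) (suc m)) (staircase m)

length-staircase : ∀ m → length (staircase m) ≡ m
staircase-fits : ∀ m → length (staircase m) ≤ length (countdown (suc m) (suc m))

length-staircase zero    = refl
length-staircase (suc m) =
  trans (length-addFirstColumn _ (staircase m) (staircase-fits m)) (length-countdown (suc m) (suc m))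

staircase-fits m = subst₂ _≤_ (sym (length-staircase m)) (sym (length-countdown (suc m) (suc m))) (n≤1+n m)

firstColumn-staircase : ∀ m → firstColumn (staircase m) ≡ countdown m m
firstColumn-staircase zero    = refl
firstColumn-staircase (suc m) = firstColumn-addFirstColumn _ (staircase m) (staircase-fits m)

DecreasingTableau-staircase : ∀ m → DecreasingTableau (staircase m)
DecreasingTableau-staircase zero    = [] , [] , []
DecreasingTableau-staircase (suc m) =
  DecreasingTableau-addFirstColumn _ (staircase m) (countdown-decreasing (suc m) (suc m))
    (DecreasingTableau-staircase m)
    (subst (λ c → Below c (countdown (suc m) (suc m))) (sym (firstColumn-staircase m))
      (Below-countdown (n≤1+n m) (s≤s (subst (m + m ≤_) (sym (+-suc m m)) (n≤1+n (m + m))))))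

staircase-entries : ∀ m → All (All (λ e → 1 ≤ e × e < 2 * m)) (staircase m)
staircase-entries zero    = []
staircase-entries (suc m) = All-addFirstColumn _ (staircase m)
  (All.map (λ {e} (1+m≤e , e<2m+1) → ≤-trans (s≤s z≤n) 1+m≤e , subst (e <_) (sym (2*m≡m+m (suc m))) e<2m+1)
    (countdown-bounds (suc m) (suc m)))
  (All.map (All.map (λ (1≤e , e<2m) → 1≤e , <-trans e<2m (*-monoʳ-< 2 (n<1+n m)))) (staircase-entries m))

readRotated-staircase : ∀ m →
  readRotated (staircase (suc m)) ≡ readRotated (staircase m) ++ countdown (suc m) (suc m)
readRotated-staircase m = readRotated-addFirstColumn (suc (m + m)) (countdown (suc m) m) (staircase m)
  (staircase-fits m) (proj₁ (DecreasingTableau-staircase m))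

act-staircase : ∀ m → act (readRotated (staircase m)) id ≗ shuffle m m
act-staircase-end : ∀ m → act (readRotated (staircase m)) id ≗ shuffle (suc m) (suc m + suc m)

act-staircase zero    x = sym (shuffle-zero x)
act-staircase (suc m) x rewrite readRotated-staircase m
                              | act-++ (readRotated (staircase m)) (countdown (suc m) (suc m)) id =
  trans (act-cong (countdown (suc m) (suc m)) (act-staircase-end m) x)
        (act-countdown (suc m) ≤-refl (≤-reflexive (sym (2*m≡m+m (suc m)))) x)

act-staircase-end m x = begin
  act (readRotated (staircase m)) id x   ≡⟨ act-staircase m x ⟩
  shuffle m m x                          ≡⟨ shuffle-end m x ⟨
  shuffle (suc m) (2 * suc m) x          ≡⟨ cong (λ j → shuffle (suc m) j x) (2*m≡m+m (suc m)) ⟩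
  shuffle (suc m) (suc m + suc m) x      ∎
  where open ≡-Reasoning

expanding-staircase : ∀ m → Expanding (readRotated (staircase m)) id
expanding-staircase zero    = tt
expanding-staircase (suc m) rewrite readRotated-staircase m =
  Expanding-++⁺ (readRotated (staircase m)) (countdown (suc m) (suc m)) id (expanding-staircase m)
    (Expanding-cong (countdown (suc m) (suc m)) (λ x → sym (act-staircase-end m x))
      (expanding-countdown (suc m) ≤-refl (≤-reflexive (sym (2*m≡m+m (suc m))))))

-- Uniqueness

prodW-fixes : ∀ w {y} → All (λ b → suc b < y) w → prodW w y ≡ y
prodW-fixes []      _          = refl
prodW-fixes (b ∷ w) (b+1<y ∷ ps) rewrite prodW-fixes w ps = s-fixes-above b+1<y

shuffle-needs-large-letter : ∀ {m w} → 1 ≤ m → act w id ≗ shuffle m m → ¬ All (λ b → suc b < 2 * m) w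
shuffle-needs-large-letter {m} {w} 1≤m w≗shuffle small = <-irrefl (sym 2m≡2m∸1) 2m∸1<2m
  where
  2m∸1<2m = ∸-monoʳ-< {o = 0} (s≤s z≤n) (≤-trans 1≤m (m≤2*m m))
  2m≡2m∸1 : 2 * m ≡ 2 * m ∸ 1
  2m≡2m∸1 = begin
    2 * m                  ≡⟨ prodW-fixes w small ⟨
    prodW w (2 * m)        ≡⟨ act≗∘prodW w id (2 * m) ⟨
    act w id (2 * m)       ≡⟨ w≗shuffle (2 * m) ⟩
    shuffle m m (2 * m)    ≡⟨ shuffle-2*m 1≤m ⟩
    2 * m ∸ 1              ∎
    where open ≡-Reasoning

expanding-into-shuffle : ∀ {m f c} → Linked _>_ c → Expanding c f → act c f ≗ shuffle m m →
  ∃ λ t → c ≡ countdown m t × m + t ≤ 2 * m × f ≗ shuffle m (m + t)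
expanding-into-shuffle {m} {f} {c} dec ex c≗shuffle
  with contracting-shuffle ≤-refl (m≤2*m m) sorted (lower-bound u sorted contracting) contracting
  where
  u = reverse c
  sorted : AllPairs _<_ u
  sorted = Linkedₚ.Linked⇒AllPairs <-trans (Linked-reverse dec)
  contracting : Contracting u (shuffle m m)
  contracting = Expanding-reverse⇒Contracting u f (shuffle m m)
    (subst (λ w → Expanding w f) (sym (reverse-involutive c)) ex)
    (λ x → trans (cong (λ w → act w f x) (reverse-involutive c)) (c≗shuffle x))
  lower-bound : ∀ u → AllPairs _<_ u → Contracting u (shuffle m m) → All (m ≤_) u
  lower-bound []      _          _       = []
  lower-bound (d ∷ u) (d<u ∷ _)  (cd , _) =
    m≤d ∷ All.map (λ d<e → ≤-trans m≤d (<⇒≤ d<e)) d<u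
    where m≤d = contracts-shuffle-diagonal cd
... | t , u≡countup , bound , acts = t , c≡countdown , bound , f≗shuffle
  where
  c≡countdown : c ≡ countdown m t
  c≡countdown = trans (sym (reverse-involutive c)) (trans (cong reverse u≡countup) (reverse-countup m t))
  f≗shuffle : f ≗ shuffle m (m + t)
  f≗shuffle x = trans (sym (act-reverse-cancel c f x)) (trans (act-cong (reverse c) c≗shuffle x) (acts x))

shuffle-column-full : ∀ {m t w} → 1 ≤ t → m + t ≤ 2 * m → All (_< m + t) w → act w id ≗ shuffle m m → t ≡ m
shuffle-column-full {m} {t} 1≤t m+t≤2m small w≗shuffle with m ≤? t
... | yes m≤t = ≤-antisym (+-cancelˡ-≤ m t m (subst (m + t ≤_) (2*m≡m+m m) m+t≤2m)) m≤t
... | no  m≰t = contradiction (All.map (λ b<m+t → <-≤-trans (s≤s b<m+t) m+t<2m) small)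
                              (shuffle-needs-large-letter (≤-trans 1≤t (<⇒≤ t<m)) w≗shuffle)
  where
  t<m = ≰⇒> m≰t
  m+t<2m = subst (m + t <_) (sym (2*m≡m+m m)) (+-monoʳ-< m t<m)

peel-firstColumn : ∀ {m} x r R → DecreasingTableau ((x ∷ r) ∷ R) →
  act (readRotated ((x ∷ r) ∷ R)) id ≗ shuffle m m → Expanding (readRotated ((x ∷ r) ∷ R)) id →
  ∃ λ m′ → m ≡ suc m′ × firstColumn ((x ∷ r) ∷ R) ≡ countdown m m
         × act (readRotated (dropFirstColumn ((x ∷ r) ∷ R))) id ≗ shuffle m′ m′
         × Expanding (readRotated (dropFirstColumn ((x ∷ r) ∷ R))) id
peel-firstColumn {m} x r R tab w≗shuffle ex =
  finish (expanding-into-shuffle (firstColumn-decreasing T tab) (proj₂ ex-split) c≗shuffle)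
  where
  T = (x ∷ r) ∷ R
  A = readRotated (dropFirstColumn T)
  c = firstColumn T
  split = readRotated-firstColumn x r R
  ex-split : Expanding A id × Expanding c (act A id)
  ex-split = Expanding-++⁻ A c id (subst (λ w → Expanding w id) split ex)
  c≗shuffle : act c (act A id) ≗ shuffle m m
  c≗shuffle y = trans (cong (λ h → h y) (sym (act-++ A c id)))
                      (trans (cong (λ w → act w id y) (sym split)) (w≗shuffle y))
  finish : (∃ λ t → c ≡ countdown m t × m + t ≤ 2 * m × act A id ≗ shuffle m (m + t)) →
    ∃ λ m′ → m ≡ suc m′ × c ≡ countdown m m × act A id ≗ shuffle m′ m′ × Expanding A id
  finish (zero  , () , _)
  finish (suc t , c≡countdown , m+t≤2m , A≗shuffle) =
    t , sym 1+t≡m , subst (λ n → c ≡ countdown m n) 1+t≡m c≡countdown , A≗shuffle′ , proj₁ ex-split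
    where
    x≡m+t : x ≡ m + t
    x≡m+t = ∷-injectiveˡ c≡countdown
    letters<m+t : All (_< m + suc t) (readRotated T)
    letters<m+t = All.map (λ {b} b≤x → subst (b <_) (trans (cong suc x≡m+t) (sym (+-suc m t))) (s≤s b≤x))
                          (All-readColumns T (width T) (entries-≤-corner x r R tab))
    1+t≡m : suc t ≡ m
    1+t≡m = shuffle-column-full (s≤s z≤n) m+t≤2m letters<m+t w≗shuffle
    A≗shuffle′ : act A id ≗ shuffle t t
    A≗shuffle′ y = begin
      act A id y                              ≡⟨ A≗shuffle y ⟩
      shuffle m (m + suc t) y                 ≡⟨ cong (λ n → shuffle n (n + suc t) y) (sym 1+t≡m) ⟩
      shuffle (suc t) (suc t + suc t) y       ≡⟨ cong (λ j → shuffle (suc t) j y) (2*m≡m+m (suc t)) ⟨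
      shuffle (suc t) (2 * suc t) y           ≡⟨ shuffle-end t y ⟩
      shuffle t t y                           ∎
      where open ≡-Reasoning

staircase-unique : ∀ m R → DecreasingTableau R →
  act (readRotated R) id ≗ shuffle m m → Expanding (readRotated R) id → R ≡ staircase m
staircase-unique zero    []            _            _          _  = refl
staircase-unique (suc m) []            _            id≗shuffle _  =
  contradiction [] (shuffle-needs-large-letter (s≤s z≤n) id≗shuffle)
staircase-unique m       ([] ∷ R)      (ne ∷ _ , _) _          _  = contradiction refl ne
staircase-unique m       ((x ∷ r) ∷ R) tab          w≗shuffle  ex
  with peel-firstColumn x r R tab w≗shuffle ex
... | m′ , refl , c≡countdown , A≗shuffle , exA = begin
  T                                                  ≡⟨ addFirstColumn-firstColumn T tab ⟨
  addFirstColumn (firstColumn T) (dropFirstColumn T) ≡⟨ cong₂ addFirstColumn c≡countdown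
      (staircase-unique m′ (dropFirstColumn T) (DecreasingTableau-dropFirstColumn T tab) A≗shuffle exA) ⟩
  staircase (suc m′)                                 ∎
  where
  open ≡-Reasoning
  T = (x ∷ r) ∷ R

-- Back to anti-straight tableaux

width-map-reverse : ∀ T → width (map reverse T) ≡ width T
width-map-reverse []      = refl
width-map-reverse (r ∷ T) = cong₂ _⊔_ (length-reverse r) (width-map-reverse T)

width-++ : ∀ T U → width (T ++ U) ≡ width T ⊔ width U
width-++ []      U = refl
width-++ (r ∷ T) U = trans (cong (length r ⊔_) (width-++ T U)) (sym (⊔-assoc (length r) (width T) (width U)))

width-reverse : ∀ T → width (reverse T) ≡ width T
width-reverse []      = refl
width-reverse (r ∷ T) = begin
  width (reverse (r ∷ T))            ≡⟨ cong width (unfold-reverse r T) ⟩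
  width (reverse T ++ r ∷ [])        ≡⟨ width-++ (reverse T) (r ∷ []) ⟩
  width (reverse T) ⊔ (length r ⊔ 0) ≡⟨ cong₂ _⊔_ (width-reverse T) (⊔-identityʳ (length r)) ⟩
  width T ⊔ length r                 ≡⟨ ⊔-comm (width T) (length r) ⟩
  width (r ∷ T)                      ∎
  where open ≡-Reasoning

read≡readRotated∘rotate : ∀ T → read T ≡ readRotated (rotate T)
read≡readRotated∘rotate T =
  cong (readColumns (rotate T)) (sym (trans (width-map-reverse (reverse T)) (width-reverse T)))

All-rows-rotate : ∀ {P : List ℕ → Set} {T} → All (P ∘ reverse) T → All P (rotate T)
All-rows-rotate {T = T} = Allₚ.map⁺ ∘ All-resp-↭ (↭-sym (↭-reverse T))

reverse≢[] : ∀ {r : List ℕ} → r ≢ [] → reverse r ≢ []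
reverse≢[] {r} r≢[] eq = r≢[] (trans (sym (reverse-involutive r)) (cong reverse eq))

IsIncAntiStraight⇒DecreasingTableau : ∀ {T} → IsIncAntiStraight T → DecreasingTableau (rotate T)
IsIncAntiStraight⇒DecreasingTableau (nes , _ , rows , cols) =
  All-rows-rotate (All.map reverse≢[] nes) ,
  All-rows-rotate (All.map Linked-reverse rows) ,
  Linkedₚ.map⁺ (Linked-reverse cols)

DecreasingTableau⇒IsIncAntiStraight : ∀ {R} → DecreasingTableau R → All (All (0 <_)) R →
  IsIncAntiStraight (rotate R)
DecreasingTableau⇒IsIncAntiStraight (nes , rows , cols) pos =
  All-rows-rotate (All.map reverse≢[] nes) ,
  All-rows-rotate (All.map All-reverse pos) ,
  All-rows-rotate (All.map Linked-reverse rows) ,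
  Linkedₚ.map⁺ (Linked.map (λ {r} {r′} → subst₂ Below (sym (reverse-involutive r)) (sym (reverse-involutive r′)))
                          (Linked-reverse cols))

module _ (m : ℕ) where

  private
    k = suc (suc m)
    a = 2 * k ∸ 3
    π = permOf (oneLine k)
    S = staircase (suc m)

  staircase-letters : All (Letter a) (readRotated S)
  staircase-letters = All-readColumns S (width S) (All.map (All.map letter) (staircase-entries (suc m)))
    where
    a≡1+2*m : a ≡ suc (2 * m)
    a≡1+2*m = trans (cong (_∸ 3) (2*[1+m]≡2+2*m (suc m))) (2*[1+m]∸1≡1+2*m m)
    letter : ∀ {e} → 1 ≤ e × e < 2 * suc m → Letter a e
    letter {e} (1≤e , e<2M) = 1≤e , subst (e ≤_) (sym a≡1+2*m) (≤-pred (subst (e <_) (2*[1+m]≡2+2*m m) e<2M))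

  staircase-wordFor : WordFor a π (readRotated S)
  staircase-wordFor = staircase-letters ,
    λ x → trans (sym (act≗∘prodW (readRotated S) id x))
                (trans (act-staircase (suc m) x) (sym (permOf-oneLine (suc m) x)))

  read-rotate-staircase : read (rotate S) ≡ readRotated S
  read-rotate-staircase = trans (read≡readRotated∘rotate (rotate S)) (cong readRotated (rotate-involutive S))

  staircase-reduced : Reduced a π (read (rotate S))
  staircase-reduced = subst (Reduced a π) (sym read-rotate-staircase)
    (expanding⇒reduced staircase-wordFor (expanding-staircase (suc m)))

  reduced⇒staircase : ∀ T → IsIncAntiStraight T → Reduced a π (read T) → T ≡ rotate S
  reduced⇒staircase T inc red = begin
    T                 ≡⟨ rotate-involutive T ⟨
    rotate (rotate T) ≡⟨ cong rotate rotated ⟩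
    rotate S          ∎
    where
    open ≡-Reasoning
    red′ : Reduced a π (readRotated (rotate T))
    red′ = subst (Reduced a π) (read≡readRotated∘rotate T) red
    rotated : rotate T ≡ S
    rotated = staircase-unique (suc m) (rotate T) (IsIncAntiStraight⇒DecreasingTableau inc)
      (λ x → trans (act-wordFor (proj₁ red′) x) (permOf-oneLine (suc m) x))
      (reduced⇒expanding staircase-wordFor (expanding-staircase (suc m)) red′)

lemma10p3 : (k : ℕ) → 2 ≤ k →
    Σ (List (List ℕ)) (λ T →
      (IsIncAntiStraight T × Reduced (2 * k ∸ 3) (permOf (oneLine k)) (read T))
      × ((T' : List (List ℕ)) → IsIncAntiStraight T' →
          Reduced (2 * k ∸ 3) (permOf (oneLine k)) (read T') → T' ≡ T))
lemma10p3 (suc zero)    (s≤s ())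
lemma10p3 (suc (suc m)) _ =
  rotate (staircase (suc m)) ,
  (DecreasingTableau⇒IsIncAntiStraight (DecreasingTableau-staircase (suc m))
     (All.map (All.map proj₁) (staircase-entries (suc m))) ,
   staircase-reduced m) ,
  reduced⇒staircase m
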